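{- Let $r,s$ be positive integers and $G=\mathbb{Z}_2^r\times\mathbb{Z}_4^s$. Among the elements of order two in $G$, exactly $2^s(2^r-1)$ have degree $1$ in the power graph $\mathcal{G}(G)$ and exactly $2^s-1$ have degree $2^{r+s}+1$ in $\mathcal{G}(G)$.
   Context: For a finite group $G$, the power graph $\mathcal{G}(G)$ is the simple graph with vertex set $G$ in which two distinct vertices are adjacent if and only if one is a power of the other. $\mathbb{Z}_k^t$ denotes the direct product of $t$ copies of the cyclic group $\mathbb{Z}_k$. -}

module Defs where

open import Data.Nat using (ℕ; zero; suc; _+_; _<_; NonZero)
open import Data.Nat.DivMod using (_mod_)
open import Data.Fin using (Fin; toℕ)
open import Data.Vec using (Vec; zipWith; replicate)
open import Data.Product using (_×_; _,_; ∃-syntax)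
open import Data.Sum using (_⊎_)
open import Data.List using (List; length)
open import Data.List.Membership.Propositional using (_∈_)
open import Data.List.Relation.Unary.Unique.Propositional using (Unique)
open import Function.Bundles using (_⇔_)
open import Relation.Nullary using (¬_)
open import Relation.Binary.PropositionalEquality using (_≡_)

_+ₙ_ : ∀ {n} .{{_ : NonZero n}} → Fin n → Fin n → Fin n
_+ₙ_ {n} a b = (toℕ a + toℕ b) mod n

G : ℕ → ℕ → Set
G r s = Vec (Fin 2) r × Vec (Fin 4) s

_∙_ : ∀ {r s} → G r s → G r s → G r s
(a , b) ∙ (c , d) = zipWith _+ₙ_ a c , zipWith _+ₙ_ b d

e : ∀ {r s} → G r s
e = replicate _ Fin.zero , replicate _ Fin.zero
  where import Data.Fin as Fin

_^_ : ∀ {r s} → G r s → ℕ → G r s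
x ^ zero = e
x ^ suc k = x ∙ (x ^ k)

IsPowerOf : ∀ {r s} → G r s → G r s → Set
IsPowerOf y x = ∃[ k ] y ≡ x ^ k

Adj : ∀ {r s} → G r s → G r s → Set
Adj x y = ¬ (x ≡ y) × (IsPowerOf y x ⊎ IsPowerOf x y)

HasOrder : ∀ {r s} → G r s → ℕ → Set
HasOrder x n = (0 < n) × (x ^ n ≡ e) × (∀ m → 0 < m → m < n → ¬ (x ^ m ≡ e))

HasSize : ∀ {r s} → (G r s → Set) → ℕ → Set
HasSize {r} {s} P n =
  ∃[ xs ] (Unique xs × length xs ≡ n × (∀ (x : G r s) → (x ∈ xs) ⇔ P x))

HasDegree : ∀ {r s} → G r s → ℕ → Set
HasDegree x d = HasSize (Adj x) d

module Submission where

-- G has exponent 4 and is cancellative, so every power of x is one of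
-- e, x, x², x³.  For an involution x this leaves as neighbours exactly e and
-- the square roots of x (a proper power y³ = x would force y = x).  Writing
-- x = (a , b), squaring kills the ℤ₂ʳ-part, so x has no square roots when
-- a ≠ 0 (degree 1), and 2ʳ·2ˢ square roots when a = 0, since then every
-- coordinate of b lies in {0, 2} and has exactly two halves in ℤ₄
-- (degree 2^(r+s) + 1).  The two degrees differ, so the involutions of degree
-- 1 are the pairs (a ≠ 0 , 2b = 0) and those of degree 2^(r+s) + 1 are the
-- pairs (0 , b ≠ 0 with 2b = 0), and both sets are counted as products.

open import Defs
open import Data.Nat using (ℕ; zero; suc; _+_; _*_; _∸_; _≤_; _<_; s≤s; z≤n)
  renaming (_^_ to _^ℕ_)
open import Data.Nat.Properties using (*-comm; *-identityˡ; +-comm; ^-distribˡ-+-*; m^n>0)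
open import Data.Fin using (Fin; zero; suc)
import Data.Fin.Properties as Fin
open import Data.Vec using (Vec; []; _∷_; zipWith; replicate; head; tail)
open import Data.Vec.Properties using (∷-injective; zipWith-identityʳ; ≡-dec)
open import Data.Vec.Relation.Unary.All as VAll using ()
  renaming (All to VecAll; [] to []ᵛ; _∷_ to _∷ᵛ_)
open import Data.Product using (_×_; _,_; ∃-syntax; proj₁; proj₂)
open import Data.Product.Properties using (,-injective)
open import Data.Sum using (_⊎_; inj₁; inj₂)
open import Data.Empty using (⊥; ⊥-elim)
open import Data.List using (List; []; _∷_; length; map; filter; allFin; cartesianProduct)
open import Data.List.Properties using (length-map; length-++; filter-accept; filter-reject; filter-all)
open import Data.List.Membership.Propositional using (_∈_)
open import Data.List.Membership.Propositional.Properties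
  using (∈-map⁺; ∈-map⁻; ∈-filter⁺; ∈-filter⁻; ∈-allFin; ∈-cartesianProduct⁺; ∈-cartesianProduct⁻)
open import Data.List.Relation.Unary.Any using (here; there)
open import Data.List.Relation.Unary.All as All using ([]; _∷_)
open import Data.List.Relation.Unary.AllPairs using ([]; _∷_)
open import Data.List.Relation.Unary.Unique.Propositional using (Unique)
import Data.List.Relation.Unary.Unique.Propositional.Properties as Unique
open import Function.Bundles using (_⇔_; mk⇔; Equivalence; _↔_; Inverse; mk↔ₛ′)
open import Function.Properties.Equivalence using () renaming (sym to ⇔-sym)
open import Relation.Nullary using (¬_; Dec; yes; no; ¬?)
open import Relation.Nullary.Decidable using (True; toWitness; _→-dec_)
open import Relation.Unary using (Decidable)
open import Relation.Binary.Definitions using (DecidableEquality)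
open import Relation.Binary.PropositionalEquality
  using (_≡_; refl; sym; trans; cong; cong₂; subst; module ≡-Reasoning)

open Equivalence using (to; from)

Count : {A : Set} → (A → Set) → ℕ → Set
Count {A} P n = ∃[ xs ] (Unique xs × length xs ≡ n × (∀ (x : A) → x ∈ xs ⇔ P x))

module _ {A : Set} where

  count-⇔ : {P Q : A → Set} {n : ℕ} → (∀ x → P x ⇔ Q x) → Count P n → Count Q n
  count-⇔ P⇔Q (xs , u , len , mem) =
    xs , u , len , λ x → mk⇔ (λ i → to (P⇔Q x) (to (mem x) i)) (λ q → from (mem x) (from (P⇔Q x) q))

  count-none : {P : A → Set} → (∀ x → ¬ P x) → Count P 0
  count-none ¬P = [] , [] , refl , λ x → mk⇔ (λ ()) (λ p → ⊥-elim (¬P x p))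

  count-single : (z : A) → Count (_≡ z) 1
  count-single z = z ∷ [] , [] ∷ [] , refl , λ x → mk⇔ (λ { (here p) → p ; (there ()) }) here

  count-insert : {P : A → Set} {n : ℕ} (z : A) → ¬ P z → Count P n →
                 Count (λ y → y ≡ z ⊎ P y) (suc n)
  count-insert {P} z ¬Pz (xs , u , len , mem) =
    z ∷ xs , All.tabulate z∉xs ∷ u , cong suc len , λ x → mk⇔ (forth x) (back x)
    where
    z∉xs : ∀ {y} → y ∈ xs → ¬ z ≡ y
    z∉xs {y} y∈xs refl = ¬Pz (to (mem y) y∈xs)
    forth : ∀ x → x ∈ z ∷ xs → x ≡ z ⊎ P x
    forth x (here p)  = inj₁ p
    forth x (there i) = inj₂ (to (mem x) i)
    back : ∀ x → x ≡ z ⊎ P x → x ∈ z ∷ xs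
    back x (inj₁ p) = here p
    back x (inj₂ q) = there (from (mem x) q)

  length-delete : (_≟_ : DecidableEquality A) (z : A) (xs : List A) → Unique xs → z ∈ xs →
                  suc (length (filter (λ y → ¬? (y ≟ z)) xs)) ≡ length xs
  length-delete _≟_ z (w ∷ ws) (w∉ws ∷ _) (here refl) =
    cong (λ l → suc (length l))
      (trans (filter-reject (λ y → ¬? (y ≟ z)) (λ ¬w≡w → ¬w≡w refl))
             (filter-all (λ y → ¬? (y ≟ z)) (All.map (λ w≢y y≡w → w≢y (sym y≡w)) w∉ws)))
  length-delete _≟_ z (w ∷ ws) (w∉ws ∷ u) (there z∈ws) =
    trans (cong (λ l → suc (length l)) (filter-accept (λ y → ¬? (y ≟ z)) (All.lookup w∉ws z∈ws)))
          (cong suc (length-delete _≟_ z ws u z∈ws))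

  count-delete : {P : A → Set} {n : ℕ} → DecidableEquality A → (z : A) → P z → Count P n →
                 Count (λ y → P y × ¬ y ≡ z) (n ∸ 1)
  count-delete _≟_ z Pz (xs , u , len , mem) =
    filter ≢z? xs , Unique.filter⁺ ≢z? u ,
    trans (cong (_∸ 1) (length-delete _≟_ z xs u (from (mem z) Pz))) (cong (_∸ 1) len) ,
    λ x → mk⇔ (λ i → let (i′ , x≢z) = ∈-filter⁻ ≢z? i in to (mem x) i′ , x≢z)
               (λ (Px , x≢z) → ∈-filter⁺ ≢z? (from (mem x) Px) x≢z)
    where
    ≢z? : Decidable (λ y → ¬ y ≡ z)
    ≢z? y = ¬? (y ≟ z)

  witnesses-coincide : {P : A → Set} → Count P 1 → ∀ {a b} → P a → P b → a ≡ b
  witnesses-coincide {P} (w ∷ [] , _ , _ , mem) {a} {b} Pa Pb = trans (is-w a Pa) (sym (is-w b Pb))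
    where
    is-w : ∀ c → P c → c ≡ w
    is-w c Pc with from (mem c) Pc
    ... | here c≡w = c≡w
  witnesses-coincide ([] , _ , () , _)
  witnesses-coincide (_ ∷ _ ∷ _ , _ , () , _)

  distinct-witnesses : {P : A → Set} {n : ℕ} → Count P n → 1 < n → ∃[ a ] ∃[ b ] (¬ a ≡ b × P a × P b)
  distinct-witnesses (a ∷ b ∷ _ , (a≢b ∷ _) ∷ _ , _ , mem) _ =
    a , b , a≢b , to (mem a) (here refl) , to (mem b) (there (here refl))
  distinct-witnesses ([] , _ , refl , _) ()
  distinct-witnesses (_ ∷ [] , _ , refl , _) (s≤s ())

  count-one-excludes-more : {P : A → Set} {n : ℕ} → Count P 1 → Count P n → 1 < n → ⊥
  count-one-excludes-more one more 1<n =
    let (a , b , a≢b , Pa , Pb) = distinct-witnesses more 1<n in a≢b (witnesses-coincide one Pa Pb)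

-- every decidable predicate on Fin n is counted by filtering the enumeration
-- of Fin n; for concrete n and P the size then evaluates to a numeral
count-Fin : {n : ℕ} {P : Fin n → Set} (P? : Decidable P) → Count P (length (filter P? (allFin n)))
count-Fin {n} P? = filter P? (allFin n) , Unique.filter⁺ P? (Unique.allFin⁺ n) , refl ,
  λ x → mk⇔ (λ i → proj₂ (∈-filter⁻ P? {xs = allFin n} i)) (∈-filter⁺ P? (∈-allFin x))

length-cartesianProduct : {A B : Set} (xs : List A) (ys : List B) →
                          length (cartesianProduct xs ys) ≡ length xs * length ys
length-cartesianProduct []       ys = refl
length-cartesianProduct (x ∷ xs) ys =
  trans (length-++ (map (x ,_) ys)) (cong₂ _+_ (length-map (x ,_) ys) (length-cartesianProduct xs ys))

module _ {A B : Set} where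

  count-× : {P : A → Set} {Q : B → Set} {m n : ℕ} → Count P m → Count Q n →
            Count (λ (a , b) → P a × Q b) (m * n)
  count-× (xs , u , lenx , memx) (ys , v , leny , memy) =
    cartesianProduct xs ys , Unique.cartesianProduct⁺ u v ,
    trans (length-cartesianProduct xs ys) (cong₂ _*_ lenx leny) ,
    λ (a , b) → mk⇔ (λ i → let (a∈ , b∈) = ∈-cartesianProduct⁻ xs ys i in to (memx a) a∈ , to (memy b) b∈)
                    (λ (Pa , Qb) → ∈-cartesianProduct⁺ (from (memx a) Pa) (from (memy b) Qb))

  count-↔ : {P : A → Set} {n : ℕ} (f : A ↔ B) → Count P n → Count (λ b → P (Inverse.from f b)) n
  count-↔ {P} f (xs , u , len , mem) =
    map to′ xs , Unique.map⁺ to′-injective u , trans (length-map to′ xs) len , λ b → mk⇔ (forth b) (back b)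
    where
    open Inverse f renaming (to to to′; from to from′)
    from∘to : ∀ a → from′ (to′ a) ≡ a
    from∘to = strictlyInverseʳ
    to∘from : ∀ b → to′ (from′ b) ≡ b
    to∘from = strictlyInverseˡ
    to′-injective : ∀ {a a′} → to′ a ≡ to′ a′ → a ≡ a′
    to′-injective {a} {a′} eq = trans (sym (from∘to a)) (trans (cong from′ eq) (from∘to a′))
    forth : ∀ b → b ∈ map to′ xs → P (from′ b)
    forth b i with ∈-map⁻ to′ i
    ... | a , a∈xs , refl = subst P (sym (from∘to a)) (to (mem a) a∈xs)
    back : ∀ b → P (from′ b) → b ∈ map to′ xs
    back b P[b] = subst (_∈ map to′ xs) (to∘from b) (∈-map⁺ to′ (from (mem (from′ b)) P[b]))

Vec-∷-↔ : {A : Set} {k : ℕ} → (A × Vec A k) ↔ Vec A (suc k)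
Vec-∷-↔ = mk↔ₛ′ (λ (a , v) → a ∷ v) (λ w → head w , tail w) (λ { (a ∷ v) → refl }) (λ _ → refl)

count-∷ : {A : Set} {k m n : ℕ} {P : A → Set} {R : Vec A k → Set} {Q : Vec A (suc k) → Set} →
          (∀ a v → (P a × R v) ⇔ Q (a ∷ v)) → Count P m → Count R n → Count Q (m * n)
count-∷ split countP countR = count-⇔ (λ { (a ∷ v) → split a v }) (count-↔ Vec-∷-↔ (count-× countP countR))

-- The coordinate groups ℤ₂ = Fin 2 and ℤ₄ = Fin 4 are written Fin (suc m).
-- The proof only uses that they have a right identity, exponent 4 and right
-- cancellation; for these two finite groups the laws are decided by evaluation.
record ExponentFourLaws (m : ℕ) : Set where
  field
    identityʳ : (a : Fin (suc m)) → a +ₙ zero ≡ a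
    period4   : (a c : Fin (suc m)) → a +ₙ (a +ₙ (a +ₙ (a +ₙ c))) ≡ c
    cancelʳ   : (a b c : Fin (suc m)) → a +ₙ c ≡ b +ₙ c → a ≡ b

decide : {P : Set} (P? : Dec P) → {True P?} → P
decide _ {valid} = toWitness valid

ℤ₂-laws : ExponentFourLaws 1
ℤ₂-laws = record
  { identityʳ = decide (Fin.all? λ a → a +ₙ zero Fin.≟ a)
  ; period4   = decide (Fin.all? λ a → Fin.all? λ c → a +ₙ (a +ₙ (a +ₙ (a +ₙ c))) Fin.≟ c)
  ; cancelʳ   = decide (Fin.all? λ a → Fin.all? λ b → Fin.all? λ c → (a +ₙ c Fin.≟ b +ₙ c) →-dec (a Fin.≟ b))
  }

ℤ₄-laws : ExponentFourLaws 3
ℤ₄-laws = record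
  { identityʳ = decide (Fin.all? λ a → a +ₙ zero Fin.≟ a)
  ; period4   = decide (Fin.all? λ a → Fin.all? λ c → a +ₙ (a +ₙ (a +ₙ (a +ₙ c))) Fin.≟ c)
  ; cancelʳ   = decide (Fin.all? λ a → Fin.all? λ b → Fin.all? λ c → (a +ₙ c Fin.≟ b +ₙ c) →-dec (a Fin.≟ b))
  }

-- zero vectors, and doubling (2v = v + (v + 0), the shape of a square in G)
zeros : {m k : ℕ} → Vec (Fin (suc m)) k
zeros {k = k} = replicate k zero

twice : {m k : ℕ} → Vec (Fin (suc m)) k → Vec (Fin (suc m)) k
twice v = zipWith _+ₙ_ v (zipWith _+ₙ_ v zeros)

module VecLaws {m : ℕ} (laws : ExponentFourLaws m) where
  open ExponentFourLaws laws

  vec-identityʳ : {k : ℕ} (v : Vec (Fin (suc m)) k) → zipWith _+ₙ_ v zeros ≡ v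
  vec-identityʳ = zipWith-identityʳ identityʳ

  vec-period4 : {k : ℕ} (v w : Vec (Fin (suc m)) k) →
                zipWith _+ₙ_ v (zipWith _+ₙ_ v (zipWith _+ₙ_ v (zipWith _+ₙ_ v w))) ≡ w
  vec-period4 []      []      = refl
  vec-period4 (a ∷ v) (c ∷ w) = cong₂ _∷_ (period4 a c) (vec-period4 v w)

  vec-cancelʳ : {k : ℕ} (v v′ w : Vec (Fin (suc m)) k) → zipWith _+ₙ_ v w ≡ zipWith _+ₙ_ v′ w → v ≡ v′
  vec-cancelʳ []      []        []      _  = refl
  vec-cancelʳ (a ∷ v) (a′ ∷ v′) (c ∷ w) eq =
    let (head≡ , tail≡) = ∷-injective eq in cong₂ _∷_ (cancelʳ a a′ c head≡) (vec-cancelʳ v v′ w tail≡)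

  twice-zeros : {k : ℕ} → twice (zeros {m} {k}) ≡ zeros
  twice-zeros = trans (cong (zipWith _+ₙ_ zeros) (vec-identityʳ zeros)) (vec-identityʳ zeros)

module ℤ₂ʳ = VecLaws ℤ₂-laws
module ℤ₄ˢ = VecLaws ℤ₄-laws

module _ {r s : ℕ} where

  ∙-identityʳ : (x : G r s) → x ∙ e ≡ x
  ∙-identityʳ (a , b) = cong₂ _,_ (ℤ₂ʳ.vec-identityʳ a) (ℤ₄ˢ.vec-identityʳ b)

  ∙-period4 : (x z : G r s) → x ∙ (x ∙ (x ∙ (x ∙ z))) ≡ z
  ∙-period4 (a , b) (c , d) = cong₂ _,_ (ℤ₂ʳ.vec-period4 a c) (ℤ₄ˢ.vec-period4 b d)

  ∙-cancelʳ : (x x′ z : G r s) → x ∙ z ≡ x′ ∙ z → x ≡ x′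
  ∙-cancelʳ (a , b) (a′ , b′) (c , d) eq =
    let (eq₁ , eq₂) = ,-injective eq in cong₂ _,_ (ℤ₂ʳ.vec-cancelʳ a a′ c eq₁) (ℤ₄ˢ.vec-cancelʳ b b′ d eq₂)

  power-cases : (x : G r s) (k : ℕ) → x ^ k ≡ e ⊎ x ^ k ≡ x ⊎ x ^ k ≡ x ^ 2 ⊎ x ^ k ≡ x ^ 3
  power-cases x 0 = inj₁ refl
  power-cases x 1 = inj₂ (inj₁ (∙-identityʳ x))
  power-cases x 2 = inj₂ (inj₂ (inj₁ refl))
  power-cases x 3 = inj₂ (inj₂ (inj₂ refl))
  power-cases x (suc (suc (suc (suc k)))) with power-cases x k
  ... | inj₁ p               = inj₁ (trans (∙-period4 x (x ^ k)) p)
  ... | inj₂ (inj₁ p)        = inj₂ (inj₁ (trans (∙-period4 x (x ^ k)) p))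
  ... | inj₂ (inj₂ (inj₁ p)) = inj₂ (inj₂ (inj₁ (trans (∙-period4 x (x ^ k)) p)))
  ... | inj₂ (inj₂ (inj₂ p)) = inj₂ (inj₂ (inj₂ (trans (∙-period4 x (x ^ k)) p)))

  cube-of-involution : {x : G r s} → x ^ 2 ≡ e → x ^ 3 ≡ x
  cube-of-involution {x} x²≡e = trans (cong (x ∙_) x²≡e) (∙-identityʳ x)

  -- ... and the cube of no other element: y³ = x gives y x = y⁴ = e = x x
  cube-root-of-involution : {x y : G r s} → x ^ 2 ≡ e → x ≡ y ^ 3 → y ≡ x
  cube-root-of-involution {x} {y} x²≡e x≡y³ = ∙-cancelʳ y x x (begin
    y ∙ x        ≡⟨ cong (y ∙_) x≡y³ ⟩
    y ^ 4        ≡⟨ ∙-period4 y e ⟩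
    e            ≡⟨ sym x²≡e ⟩
    x ∙ (x ∙ e)  ≡⟨ cong (x ∙_) (∙-identityʳ x) ⟩
    x ∙ x        ∎)
    where open ≡-Reasoning

  neighbours-of-involution : {x : G r s} → x ^ 2 ≡ e → ¬ x ≡ e → (y : G r s) →
                             Adj x y ⇔ (y ≡ e ⊎ y ^ 2 ≡ x)
  neighbours-of-involution {x} x²≡e x≢e y = mk⇔ forth back
    where
    forth : Adj x y → y ≡ e ⊎ y ^ 2 ≡ x
    forth (x≢y , inj₁ (k , y≡xᵏ)) with power-cases x k
    ... | inj₁ xᵏ≡e                = inj₁ (trans y≡xᵏ xᵏ≡e)
    ... | inj₂ (inj₁ xᵏ≡x)         = ⊥-elim (x≢y (sym (trans y≡xᵏ xᵏ≡x)))
    ... | inj₂ (inj₂ (inj₁ xᵏ≡x²)) = inj₁ (trans y≡xᵏ (trans xᵏ≡x² x²≡e))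
    ... | inj₂ (inj₂ (inj₂ xᵏ≡x³)) = ⊥-elim (x≢y (sym (trans y≡xᵏ (trans xᵏ≡x³ (cube-of-involution x²≡e)))))
    forth (x≢y , inj₂ (k , x≡yᵏ)) with power-cases y k
    ... | inj₁ yᵏ≡e                = ⊥-elim (x≢e (trans x≡yᵏ yᵏ≡e))
    ... | inj₂ (inj₁ yᵏ≡y)         = ⊥-elim (x≢y (trans x≡yᵏ yᵏ≡y))
    ... | inj₂ (inj₂ (inj₁ yᵏ≡y²)) = inj₂ (sym (trans x≡yᵏ yᵏ≡y²))
    ... | inj₂ (inj₂ (inj₂ yᵏ≡y³)) = ⊥-elim (x≢y (sym (cube-root-of-involution x²≡e (trans x≡yᵏ yᵏ≡y³))))
    back : y ≡ e ⊎ y ^ 2 ≡ x → Adj x y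
    back (inj₁ refl) = x≢e , inj₁ (0 , refl)
    back (inj₂ y²≡x) = x≢y , inj₂ (2 , sym y²≡x)
      where
      x≢y : ¬ x ≡ y
      x≢y x≡y = x≢e (trans (sym y²≡x) (subst (λ z → z ^ 2 ≡ e) x≡y x²≡e))

  degree-of-involution : {x : G r s} {n : ℕ} → x ^ 2 ≡ e → ¬ x ≡ e →
                         Count (λ y → y ^ 2 ≡ x) n → HasDegree x (suc n)
  degree-of-involution {x} x²≡e x≢e roots =
    count-⇔ (λ y → ⇔-sym (neighbours-of-involution x²≡e x≢e y)) (count-insert e e²≢x roots)
    where
    e²≢x : ¬ e ^ 2 ≡ x
    e²≢x e²≡x = x≢e (trans (sym e²≡x) (trans (cong (e ∙_) (∙-identityʳ e)) (∙-identityʳ e)))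

-- Square roots in G are computed coordinatewise: y² = x means that each
-- coordinate of y is a half of the corresponding coordinate of x.
Half : {m : ℕ} → Fin (suc m) → Fin (suc m) → Set
Half c a = a +ₙ (a +ₙ zero) ≡ c

count-halves : {m k n : ℕ} (b : Vec (Fin (suc m)) k) → VecAll (λ c → Count (Half c) n) b →
               Count (λ v → twice v ≡ b) (n ^ℕ k)
count-halves []      []ᵛ         = count-⇔ (λ { [] → mk⇔ (λ _ → refl) (λ _ → refl) }) (count-single [])
count-halves (c ∷ b) (hc ∷ᵛ hb) =
  count-∷ (λ a v → mk⇔ (λ (p , q) → cong₂ _∷_ p q) ∷-injective) hc (count-halves b hb)

all-zeros : {m k : ℕ} {P : Fin (suc m) → Set} → P zero → VecAll P (zeros {m} {k})
all-zeros {k = zero}  _  = []ᵛ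
all-zeros {k = suc k} P0 = P0 ∷ᵛ all-zeros P0

twice-zero-coordinates : {m k : ℕ} (b : Vec (Fin (suc m)) k) → twice b ≡ zeros → VecAll (λ c → Half zero c) b
twice-zero-coordinates []      _     = []ᵛ
twice-zero-coordinates (c ∷ b) 2b≡0 =
  let (2c≡0 , 2b′≡0) = ∷-injective 2b≡0 in 2c≡0 ∷ᵛ twice-zero-coordinates b 2b′≡0

twice-ℤ₂ : {k : ℕ} (a : Vec (Fin 2) k) → twice a ≡ zeros
twice-ℤ₂ []      = refl
twice-ℤ₂ (c ∷ a) = cong₂ _∷_ (decide (Fin.all? λ c → c +ₙ (c +ₙ zero) Fin.≟ zero) c) (twice-ℤ₂ a)

-- ... so counting the halves of 0 counts ℤ₂ʳ, which has 2ʳ elements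
count-ℤ₂ : (k : ℕ) → Count (λ a → twice a ≡ zeros {1} {k}) (2 ^ℕ k)
count-ℤ₂ k = count-halves zeros (all-zeros (count-Fin (λ c → c +ₙ (c +ₙ zero) Fin.≟ zero)))

-- in ℤ₄ the elements of order at most 2 are 0 and 2, with halves {0, 2} and {1, 3}
halves-ℤ₄ : (c : Fin 4) → Half zero c → Count (Half c) 2
halves-ℤ₄ zero                   _ = count-Fin (λ a → a +ₙ (a +ₙ zero) Fin.≟ zero)
halves-ℤ₄ (suc (suc zero))       _ = count-Fin (λ a → a +ₙ (a +ₙ zero) Fin.≟ suc (suc zero))
halves-ℤ₄ (suc zero)             ()
halves-ℤ₄ (suc (suc (suc zero))) ()

count-halves-ℤ₄ : {k : ℕ} (b : Vec (Fin 4) k) → twice b ≡ zeros → Count (λ d → twice d ≡ b) (2 ^ℕ k)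
count-halves-ℤ₄ b 2b≡0 = count-halves b (VAll.map (λ {c} → halves-ℤ₄ c) (twice-zero-coordinates b 2b≡0))

module _ {r s : ℕ} where

  count-square-roots : {a : Vec (Fin 2) r} {b : Vec (Fin 4) s} {m n : ℕ} →
                       Count (λ c → twice c ≡ a) m → Count (λ d → twice d ≡ b) n →
                       Count (λ y → y ^ 2 ≡ (a , b)) (m * n)
  count-square-roots halves-a halves-b =
    count-⇔ (λ _ → mk⇔ (λ (p , q) → cong₂ _,_ p q) ,-injective) (count-× halves-a halves-b)

  order-two⇔ : (x : G r s) → HasOrder x 2 ⇔ (x ^ 2 ≡ e × ¬ x ≡ e)
  order-two⇔ x = mk⇔
    (λ (_ , x²≡e , minimal) → x²≡e , λ x≡e → minimal 1 (s≤s z≤n) (s≤s (s≤s z≤n)) (trans (∙-identityʳ x) x≡e))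
    (λ (x²≡e , x≢e) → s≤s z≤n , x²≡e , λ where
      (suc zero) _ _ x¹≡e → x≢e (trans (sym (∙-identityʳ x)) x¹≡e)
      (suc (suc _)) _ (s≤s (s≤s ())))

  -- squaring annihilates the ℤ₂ʳ-part, so x² = e is a condition on the ℤ₄ˢ-part only
  square≡e⇔ : (a : Vec (Fin 2) r) (b : Vec (Fin 4) s) → (a , b) ^ 2 ≡ e ⇔ twice b ≡ zeros
  square≡e⇔ a b = mk⇔ (cong proj₂) (cong₂ _,_ (twice-ℤ₂ a))

  degree-nonzero-ℤ₂-part : {a : Vec (Fin 2) r} {b : Vec (Fin 4) s} →
                           (a , b) ^ 2 ≡ e → ¬ (a , b) ≡ e → ¬ a ≡ zeros → HasDegree (a , b) 1
  degree-nonzero-ℤ₂-part x²≡e x≢e a≢0 = degree-of-involution x²≡e x≢e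
    (count-none (λ (c , _) y²≡x → a≢0 (trans (sym (cong proj₁ y²≡x)) (twice-ℤ₂ c))))

  degree-zero-ℤ₂-part : {b : Vec (Fin 4) s} →
                        (zeros , b) ^ 2 ≡ e → ¬ (zeros , b) ≡ e → HasDegree (zeros , b) (2 ^ℕ (r + s) + 1)
  degree-zero-ℤ₂-part {b} x²≡e x≢e = subst (HasDegree (zeros , b)) size
    (degree-of-involution x²≡e x≢e (count-square-roots (count-ℤ₂ r) (count-halves-ℤ₄ b (cong proj₂ x²≡e))))
    where
    size : suc (2 ^ℕ r * 2 ^ℕ s) ≡ 2 ^ℕ (r + s) + 1
    size = trans (cong suc (sym (^-distribˡ-+-* 2 r s))) (+-comm 1 _)

  -- the two degrees differ, so which one an involution has is decided by its ℤ₂ʳ-part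
  one<degree : 1 < 2 ^ℕ (r + s) + 1
  one<degree = subst (1 <_) (+-comm 1 (2 ^ℕ (r + s))) (s≤s (m^n>0 2 (r + s)))

  degree-one⇔ : {a : Vec (Fin 2) r} {b : Vec (Fin 4) s} → (a , b) ^ 2 ≡ e → ¬ (a , b) ≡ e →
                HasDegree (a , b) 1 ⇔ (¬ a ≡ zeros)
  degree-one⇔ x²≡e x≢e = mk⇔
    (λ { degree-one refl → count-one-excludes-more degree-one (degree-zero-ℤ₂-part x²≡e x≢e) one<degree })
    (degree-nonzero-ℤ₂-part x²≡e x≢e)

  degree-big⇔ : {a : Vec (Fin 2) r} {b : Vec (Fin 4) s} → (a , b) ^ 2 ≡ e → ¬ (a , b) ≡ e →
                HasDegree (a , b) (2 ^ℕ (r + s) + 1) ⇔ (a ≡ zeros)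
  degree-big⇔ {a} x²≡e x≢e = mk⇔ forth (λ { refl → degree-zero-ℤ₂-part x²≡e x≢e })
    where
    forth : HasDegree (a , _) (2 ^ℕ (r + s) + 1) → a ≡ zeros
    forth degree-big with ≡-dec Fin._≟_ a zeros
    ... | yes a≡0 = a≡0
    ... | no  a≢0 = ⊥-elim (count-one-excludes-more (degree-nonzero-ℤ₂-part x²≡e x≢e a≢0) degree-big one<degree)

  degree-one-involutions⇔ : (x : G r s) → (HasOrder x 2 × HasDegree x 1) ⇔
                            ((twice (proj₁ x) ≡ zeros × ¬ proj₁ x ≡ zeros) × twice (proj₂ x) ≡ zeros)
  degree-one-involutions⇔ (a , b) = mk⇔ forth back
    where
    forth : HasOrder (a , b) 2 × HasDegree (a , b) 1 → (twice a ≡ zeros × ¬ a ≡ zeros) × twice b ≡ zeros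
    forth (order-two , degree-one) =
      let (x²≡e , x≢e) = to (order-two⇔ (a , b)) order-two
      in (twice-ℤ₂ a , to (degree-one⇔ x²≡e x≢e) degree-one) , to (square≡e⇔ a b) x²≡e
    back : (twice a ≡ zeros × ¬ a ≡ zeros) × twice b ≡ zeros → HasOrder (a , b) 2 × HasDegree (a , b) 1
    back ((_ , a≢0) , 2b≡0) =
      let x²≡e = from (square≡e⇔ a b) 2b≡0
          x≢e  = λ x≡e → a≢0 (cong proj₁ x≡e)
      in from (order-two⇔ (a , b)) (x²≡e , x≢e) , from (degree-one⇔ x²≡e x≢e) a≢0

  degree-big-involutions⇔ : (x : G r s) → (HasOrder x 2 × HasDegree x (2 ^ℕ (r + s) + 1)) ⇔
                            (proj₁ x ≡ zeros × (twice (proj₂ x) ≡ zeros × ¬ proj₂ x ≡ zeros))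
  degree-big-involutions⇔ (a , b) = mk⇔ forth back
    where
    forth : HasOrder (a , b) 2 × HasDegree (a , b) (2 ^ℕ (r + s) + 1) →
            a ≡ zeros × (twice b ≡ zeros × ¬ b ≡ zeros)
    forth (order-two , degree-big) =
      let (x²≡e , x≢e) = to (order-two⇔ (a , b)) order-two
          a≡0          = to (degree-big⇔ x²≡e x≢e) degree-big
      in a≡0 , to (square≡e⇔ a b) x²≡e , λ b≡0 → x≢e (cong₂ _,_ a≡0 b≡0)
    back : a ≡ zeros × (twice b ≡ zeros × ¬ b ≡ zeros) →
           HasOrder (a , b) 2 × HasDegree (a , b) (2 ^ℕ (r + s) + 1)
    back (a≡0 , 2b≡0 , b≢0) =
      let x²≡e = from (square≡e⇔ a b) 2b≡0
          x≢e  = λ x≡e → b≢0 (cong proj₂ x≡e)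
      in from (order-two⇔ (a , b)) (x²≡e , x≢e) , from (degree-big⇔ x²≡e x≢e) a≡0

-- Both sets are products: {a ≠ 0} × {2b = 0} has (2ʳ − 1) · 2ˢ elements and
-- {0} × {b ≠ 0, 2b = 0} has 1 · (2ˢ − 1).
proposition3p10 : (r s : ℕ) → 1 ≤ r → 1 ≤ s →
    HasSize {r} {s} (λ x → HasOrder x 2 × HasDegree x 1) (2 ^ℕ s * (2 ^ℕ r ∸ 1))
    × HasSize {r} {s} (λ x → HasOrder x 2 × HasDegree x (2 ^ℕ (r + s) + 1)) (2 ^ℕ s ∸ 1)
proposition3p10 r s _ _ = degree-one-count , degree-big-count
  where
  nonzero-ℤ₂ʳ : Count (λ a → twice a ≡ zeros × ¬ a ≡ zeros) (2 ^ℕ r ∸ 1)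
  nonzero-ℤ₂ʳ = count-delete (≡-dec Fin._≟_) zeros (twice-ℤ₂ zeros) (count-ℤ₂ r)

  order-≤2-ℤ₄ˢ : Count (λ b → twice b ≡ zeros) (2 ^ℕ s)
  order-≤2-ℤ₄ˢ = count-halves-ℤ₄ zeros ℤ₄ˢ.twice-zeros

  order-2-ℤ₄ˢ : Count (λ b → twice b ≡ zeros × ¬ b ≡ zeros) (2 ^ℕ s ∸ 1)
  order-2-ℤ₄ˢ = count-delete (≡-dec Fin._≟_) zeros ℤ₄ˢ.twice-zeros order-≤2-ℤ₄ˢ

  degree-one-count : HasSize {r} {s} (λ x → HasOrder x 2 × HasDegree x 1) (2 ^ℕ s * (2 ^ℕ r ∸ 1))
  degree-one-count = subst (Count _) (*-comm (2 ^ℕ r ∸ 1) (2 ^ℕ s))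
    (count-⇔ (λ x → ⇔-sym (degree-one-involutions⇔ x)) (count-× nonzero-ℤ₂ʳ order-≤2-ℤ₄ˢ))

  degree-big-count : HasSize {r} {s} (λ x → HasOrder x 2 × HasDegree x (2 ^ℕ (r + s) + 1)) (2 ^ℕ s ∸ 1)
  degree-big-count = subst (Count _) (*-identityˡ (2 ^ℕ s ∸ 1))
    (count-⇔ (λ x → ⇔-sym (degree-big-involutions⇔ x)) (count-× (count-single zeros) order-2-ℤ₄ˢ))
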